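{- Let $n$ be an odd perfect square. Then $C_{S(n)^*}\leq 9$.
   Context: $\mathbb Z_n=\mathbb Z/n\mathbb Z$; $S(n)^*=\{x^2:x\in\mathbb Z_n\}\setminus\{0\}$. For $A\subseteq\mathbb Z_n$, a subsequence $T$ of a sequence $(x_1,\dots,x_k)$ in $\mathbb Z_n$, with nonempty index set $I$, is an $A$-weighted zero-sum subsequence if there exist $a_i\in A$ ($i\in I$) with $\sum_{i\in I}a_ix_i=0$. $C_{S(n)^*}$ is the least positive integer $k$ such that every sequence of length $k$ in $\mathbb Z_n$ has an $S(n)^*$-weighted zero-sum subsequence consisting of consecutive terms. -}

module Defs where

open import Data.Nat using (ℕ; zero; suc; _+_; _*_; _≤_; _<_)
open import Data.Nat.Divisibility using (_∣_)
open import Data.Fin using (Fin; toℕ)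
open import Data.List using (List; []; _∷_; _++_; length; zipWith)
open import Data.Nat.ListAction using (sum)
open import Data.List.Relation.Unary.All using (All)
open import Data.Product using (Σ; ∃; ∃-syntax; _×_; _,_)
open import Relation.Binary.PropositionalEquality using (_≡_; _≢_)

-- Elements of ℤ_n are represented by Fin n (canonical residues 0,…,n-1);
-- ring operations are performed on representatives in ℕ and read modulo n.

SqStar : (n : ℕ) → Fin n → Set
SqStar n a = (toℕ a ≢ 0) × (Σ (Fin n) λ x → ∃[ q ] (toℕ x * toℕ x ≡ q * n + toℕ a))

weightedSum : {n : ℕ} → List (Fin n) → List (Fin n) → ℕ
weightedSum ws xs = sum (zipWith (λ w x → toℕ w * toℕ x) ws xs)

HasConsecWZS : (n : ℕ) → List (Fin n) → Set
HasConsecWZS n xs =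
  ∃[ pre ] ∃[ seg ] ∃[ suf ]
    (xs ≡ pre ++ seg ++ suf) × (1 ≤ length seg) ×
    (∃[ ws ] (length ws ≡ length seg) × All (SqStar n) ws × (n ∣ weightedSum ws seg))

AllHaveConsecWZS : (n k : ℕ) → Set
AllHaveConsecWZS n k = (xs : List (Fin n)) → length xs ≡ k → HasConsecWZS n xs

IsC : (n c : ℕ) → Set
IsC n c = (1 ≤ c) × AllHaveConsecWZS n c × ((k : ℕ) → 1 ≤ k → AllHaveConsecWZS n k → c ≤ k)

Odd : ℕ → Set
Odd n = ∃[ r ] (n ≡ suc (2 * r))

-- Let p be a prime factor of m, so n = (m'p)². If integers cᵢ prime to p make Σ cᵢ² xᵢ divisible
-- by p², then the weights (m'cᵢ)² are nonzero squares in ℤ_n and Σ (m'cᵢ)² xᵢ is divisible by n, so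
-- it suffices to find such weights on a segment of any nine integers.
-- Each term is divisible by p², a unit modulo p, or p times a unit. For units u, v, w modulo p, one of
-- c²u + d²v, d²v + e²w, c²u + d²v + e²w vanishes for some units c, d, e: this is immediate when -uv or
-- -vw is a square, and otherwise follows from the squares having index 2 in (ℤ/p)ˣ. Three consecutive
-- multiples pu, pv, pw are therefore handled directly; three units separated by multiples of p are
-- handled by giving those multiples weight 1 and lifting the solution from p to p² by Hensel's lemma
-- on the weight of the first unit. Any three consecutive terms contain a term divisible by p², three
-- multiples of p or a unit, so nine terms always contain one of these configurations.
module Submission where

open import Data.Nat as ℕ using (ℕ; zero; suc; z≤n; s≤s; NonZero)
import Data.Nat.Properties as ℕP
import Data.Nat.Divisibility as ℕD
open import Data.Nat.DivMod using (_%_; _/_; m%n<n; m≡m%n+[m/n]*n; %-distribˡ-*; [m+kn]%n≡m%n; m<n⇒m%n≡m)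
open import Data.Nat.Coprimality using (Coprime; coprime-Bézout)
open import Data.Nat.GCD using (module Bézout)
open import Data.Nat.Primality using (Prime; euclidsLemma; prime⇒irreducible; prime⇒nonZero; prime⇒nonTrivial)
open import Data.Nat.Primality.Factorisation using (factorise)
open import Data.Nat.ListAction using (product)
import Data.Nat.Tactic.RingSolver as ℕSolver
open import Data.Integer as Int using (ℤ; +_; -[1+_]) renaming (∣_∣ to abs)
import Data.Integer.Properties as ℤP
import Data.Integer.DivMod as ℤDM
open import Data.Integer.Divisibility.Signed
open import Data.Integer.Tactic.RingSolver using (solve-∀)
open import Data.Fin as Fin using (Fin; toℕ; fromℕ<)
open import Data.Fin.Patterns using (0F; 1F; 2F)
import Data.Fin.Properties as FinP
open import Data.List using (List; []; _∷_; _++_; length; map; [_])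
open import Data.List.Properties using (++-assoc; length-++; length-map; ∷-injective)
open import Data.List.Relation.Unary.All using (All; []; _∷_)
import Data.List.Relation.Unary.All.Properties as AllP
open import Data.Product using (Σ; ∃; ∃₂; ∃-syntax; _×_; _,_; proj₁; proj₂; uncurry)
open import Data.Sum using (_⊎_; inj₁; inj₂; [_,_]′)
open import Data.Empty using (⊥-elim)
open import Function using (_∘_; id)
open import Level using (0ℓ)
open import Relation.Nullary using (¬_; Dec; yes; no; ¬?)
open import Relation.Nullary.Decidable using (_×-dec_; map′)
open import Relation.Unary using (Pred; Decidable)
open import Relation.Binary.Definitions using (tri<; tri≈; tri>)
open import Relation.Binary.PropositionalEquality hiding ([_])
open import Defs

∣-resp-≡ : ∀ {k x y} → x ≡ y → k ∣ y → k ∣ x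
∣-resp-≡ refl k∣y = k∣y

module _ where
  open Int using (_+_; _*_; _-_; -_)

  sqWeightedSum : List ℤ → List ℤ → ℤ
  sqWeightedSum (c ∷ cs) (x ∷ xs) = c * c * x + sqWeightedSum cs xs
  sqWeightedSum _ _ = + 0

  sqWeightedSum-++ : ∀ cs xs {ds ys} → length cs ≡ length xs →
                     sqWeightedSum (cs ++ ds) (xs ++ ys) ≡ sqWeightedSum cs xs + sqWeightedSum ds ys
  sqWeightedSum-++ [] [] _ = sym (ℤP.+-identityˡ _)
  sqWeightedSum-++ (c ∷ cs) (x ∷ xs) len =
    trans (cong (λ s → c * c * x + s) (sqWeightedSum-++ cs xs (ℕP.suc-injective len)))
          (sym (ℤP.+-assoc (c * c * x) _ _))

  sqWeightedSum-*ʳ : ∀ cs xs k → sqWeightedSum cs (map (_* k) xs) ≡ sqWeightedSum cs xs * k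
  sqWeightedSum-*ʳ [] _ k = refl
  sqWeightedSum-*ʳ (c ∷ cs) [] k = refl
  sqWeightedSum-*ʳ (c ∷ cs) (x ∷ xs) k =
    trans (cong (λ s → c * c * (x * k) + s) (sqWeightedSum-*ʳ cs xs k)) (distrib c x _ k)
    where distrib : ∀ c x s k → c * c * (x * k) + s * k ≡ (c * c * x + s) * k
          distrib = solve-∀

  x*x≡+abs[x]*abs[x] : ∀ x → x * x ≡ + (abs x ℕ.* abs x)
  x*x≡+abs[x]*abs[x] (+ k) = sym (ℤP.pos-* k k)
  x*x≡+abs[x]*abs[x] -[1+ k ] = refl

-- Units and squares modulo a prime

module ModPrime (p : ℕ) (p-prime : Prime p) where
  open Int using (_+_; _*_; _-_; -_)

  instance
    p≢0 : NonZero p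
    p≢0 = prime⇒nonZero p-prime

  P : ℤ
  P = + p

  Unit : ℤ → Set
  Unit x = ¬ (P ∣ x)

  p∣xy⇒p∣x⊎p∣y : ∀ x y → P ∣ x * y → P ∣ x ⊎ P ∣ y
  p∣xy⇒p∣x⊎p∣y x y p∣xy
    with euclidsLemma (abs x) (abs y) p-prime (subst (p ℕD.∣_) (ℤP.abs-* x y) (∣⇒∣ᵤ p∣xy))
  ... | inj₁ p∣x = inj₁ (∣ᵤ⇒∣ p∣x)
  ... | inj₂ p∣y = inj₂ (∣ᵤ⇒∣ p∣y)

  unit-* : ∀ {x y} → Unit x → Unit y → Unit (x * y)
  unit-* {x} {y} ux uy p∣xy = [ ux , uy ]′ (p∣xy⇒p∣x⊎p∣y x y p∣xy)

  unit-cancel : ∀ {c x} → Unit c → P ∣ c * x → P ∣ x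
  unit-cancel {c} {x} uc p∣cx = [ ⊥-elim ∘ uc , id ]′ (p∣xy⇒p∣x⊎p∣y c x p∣cx)

  unit-neg : ∀ {x} → Unit x → Unit (- x)
  unit-neg {x} ux p∣-x = ux (subst (P ∣_) (ℤP.neg-involutive x) (∣m⇒∣-m p∣-x))

  unit-cong : ∀ {x y} → P ∣ x - y → Unit x → Unit y
  unit-cong {x} {y} p∣x-y ux p∣y = ux (∣-resp-≡ (eq x y) (∣m∣n⇒∣m+n p∣x-y p∣y))
    where eq : ∀ x y → x ≡ x - y + y
          eq = solve-∀

  unit-root : ∀ w {x} → P ∣ w * w - x → Unit x → Unit w
  unit-root w {x} p∣w²-x ux p∣w = ux (∣-resp-≡ (eq w x) (∣m∣n⇒∣m-n (∣n⇒∣m*n w p∣w) p∣w²-x))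
    where eq : ∀ w x → x ≡ w * w - (w * w - x)
          eq = solve-∀

  1<p : 1 ℕ.< p
  1<p = ℕ.nonTrivial⇒n>1 p {{prime⇒nonTrivial p-prime}}

  small⇒unit : ∀ {k} → 0 ℕ.< k → k ℕ.< p → Unit (+ k)
  small⇒unit {k} 0<k k<p p∣k = ℕP.<⇒≱ k<p (ℕD.∣⇒≤ {{ℕ.>-nonZero 0<k}} (∣⇒∣ᵤ p∣k))

  unit-1 : Unit (+ 1)
  unit-1 = small⇒unit (s≤s z≤n) 1<p

  ∣-small⇒≡ : ∀ {a b} → a ℕ.< p → b ℕ.< p → P ∣ + a - + b → a ≡ b
  ∣-small⇒≡ {a} {b} a<p b<p p∣a-b with ℕP.<-cmp a b
  ... | tri≈ _ a≡b _ = a≡b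
  ... | tri< a<b _ _ = ⊥-elim (small⇒unit (ℕP.m<n⇒0<n∸m a<b) (ℕP.≤-<-trans (ℕP.m∸n≤m b a) b<p)
          (subst (P ∣_) (trans (cong -_ (trans (ℤP.m-n≡m⊖n a b) (ℤP.⊖-< a<b))) (ℤP.neg-involutive _))
                 (∣m⇒∣-m p∣a-b)))
  ... | tri> _ _ b<a = ⊥-elim (small⇒unit (ℕP.m<n⇒0<n∸m b<a) (ℕP.≤-<-trans (ℕP.m∸n≤m a b) a<p)
          (subst (P ∣_) (trans (ℤP.m-n≡m⊖n a b) (ℤP.⊖-≥ (ℕP.<⇒≤ b<a))) p∣a-b))

  unit⇒coprime : ∀ {k} → Unit (+ k) → Coprime k p
  unit⇒coprime uk {d} (d∣k , d∣p) with prime⇒irreducible p-prime d∣p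
  ... | inj₁ d≡1 = d≡1
  ... | inj₂ refl = ⊥-elim (uk (∣ᵤ⇒∣ d∣k))

  unit⇒invertibleℕ : ∀ k → Unit (+ k) → ∃ λ ι → P ∣ ι * + k - + 1
  unit⇒invertibleℕ k uk with coprime-Bézout (unit⇒coprime uk)
  ... | Bézout.+- x y 1+yp≡xk = + x , divides (+ y) (begin
        + x * + k - + 1          ≡⟨ cong (_- + 1) (sym (ℤP.pos-* x k)) ⟩
        + (x ℕ.* k) - + 1        ≡⟨ cong (λ t → + t - + 1) (sym 1+yp≡xk) ⟩
        + (1 ℕ.+ y ℕ.* p) - + 1  ≡⟨ cong (_- + 1) (ℤP.pos-+ 1 (y ℕ.* p)) ⟩
        + 1 + + (y ℕ.* p) - + 1  ≡⟨ cancel (+ (y ℕ.* p)) ⟩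
        + (y ℕ.* p)              ≡⟨ ℤP.pos-* y p ⟩
        + y * P                  ∎)
    where open ≡-Reasoning
          cancel : ∀ z → + 1 + z - + 1 ≡ z
          cancel = solve-∀
  ... | Bézout.-+ x y 1+xk≡yp = - + x , divides (- + y) (begin
        - + x * + k - + 1        ≡⟨ negate (+ x) (+ k) ⟩
        - (+ 1 + + x * + k)      ≡⟨ cong (λ t → - (+ 1 + t)) (sym (ℤP.pos-* x k)) ⟩
        - + (1 ℕ.+ x ℕ.* k)      ≡⟨ cong (λ t → - + t) 1+xk≡yp ⟩
        - + (y ℕ.* p)            ≡⟨ cong -_ (ℤP.pos-* y p) ⟩
        - (+ y * P)              ≡⟨ ℤP.neg-distribˡ-* (+ y) P ⟩
        - + y * P                ∎)
    where open ≡-Reasoning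
          negate : ∀ x k → - x * k - + 1 ≡ - (+ 1 + x * k)
          negate = solve-∀

  -- Inverting x * x instead of x avoids a case split on the sign of x.
  unit⇒invertible : ∀ {x} → Unit x → ∃ λ ι → P ∣ ι * x - + 1
  unit⇒invertible {x} ux with unit⇒invertibleℕ (abs x ℕ.* abs x)
                                (subst Unit (x*x≡+abs[x]*abs[x] x) (unit-* ux ux))
  ... | ι , p∣ιx²-1 =
    ι * x , ∣-resp-≡ (trans (reassoc ι x) (cong (λ t → ι * t - + 1) (x*x≡+abs[x]*abs[x] x))) p∣ιx²-1
    where reassoc : ∀ ι x → ι * x * x - + 1 ≡ ι * (x * x) - + 1
          reassoc = solve-∀

  -- Roots are taken in Fin p so that being a square is decidable.
  Square : ℤ → Set
  Square x = Σ (Fin p) λ r → P ∣ + toℕ r * + toℕ r - x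

  square? : ∀ x → Dec (Square x)
  square? x = FinP.any? (λ r → P ∣? (+ toℕ r * + toℕ r - x))

  square-intro : ∀ w x → P ∣ w * w - x → Square x
  square-intro w x p∣w²-x = fromℕ< r<p , subst (λ t → P ∣ + t * + t - x) (sym (FinP.toℕ-fromℕ< r<p)) p∣r²-x
    where
      r<p = ℤDM.n%d<d w P
      r = + (w ℤDM.% P)
      q = w ℤDM./ P
      reduce : ∀ r q P x → r * r - x ≡ ((r + q * P) * (r + q * P) - x) + (- (r * q) - r * q - q * q * P) * P
      reduce = solve-∀
      p∣r²-x : P ∣ r * r - x
      p∣r²-x = ∣-resp-≡ (trans (reduce r q P x) (cong (λ t → (t * t - x) + (- (r * q) - r * q - q * q * P) * P)
                                                        (sym (ℤDM.a≡a%n+[a/n]*n w P))))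
                        (∣m∣n⇒∣m+n p∣w²-x (∣n⇒∣m*n (- (r * q) - r * q - q * q * P) ∣-refl))

  square-root : ∀ {x} → Square x → ∃ λ w → P ∣ w * w - x
  square-root (r , p∣r²-x) = + toℕ r , p∣r²-x

  square-cong : ∀ {x y} → Square x → P ∣ x - y → Square y
  square-cong {x} {y} sx p∣x-y with square-root sx
  ... | w , p∣w²-x = square-intro w y (∣-resp-≡ (split w x y) (∣m∣n⇒∣m+n p∣w²-x p∣x-y))
    where split : ∀ w x y → w * w - y ≡ (w * w - x) + (x - y)
          split = solve-∀

  square-1 : Square (+ 1)
  square-1 = square-intro (+ 1) (+ 1) (divides (+ 0) refl)

  -- c s² ≡ c' t² with s invertible gives c c' ≡ (s⁻¹ c' t)².
  square-product : ∀ c c' s t → Unit s → P ∣ c * (s * s) - c' * (t * t) → Square (c * c')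
  square-product c c' s t us p∣cs²-c't² = square-intro (ι * c' * t) (c * c')
    (∣-resp-≡ (identity c c' s t ι)
              (∣m∣n⇒∣m+n (∣n⇒∣m*n (- (ι * ι * c')) p∣cs²-c't²)
                         (∣n⇒∣m*n (c * c' * (ι * s + + 1)) p∣ιs-1)))
    where
      ι = proj₁ (unit⇒invertible us)
      p∣ιs-1 = proj₂ (unit⇒invertible us)
      identity : ∀ c c' s t ι → ι * c' * t * (ι * c' * t) - c * c'
                 ≡ - (ι * ι * c') * (c * (s * s) - c' * (t * t)) + c * c' * (ι * s + + 1) * (ι * s - + 1)
      identity = solve-∀

-- Squares modulo an odd prime

remQuot-injective : ∀ {m} k {i j : Fin (m ℕ.* k)} → Fin.remQuot {m} k i ≡ Fin.remQuot k j → i ≡ j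
remQuot-injective {m} k {i} {j} eq =
  trans (sym (FinP.combine-remQuot {m} k i)) (trans (cong (uncurry Fin.combine) eq) (FinP.combine-remQuot {m} k j))

module QuadraticCharacter (p : ℕ) (p-prime : Prime p) (h : ℕ) (p≡1+2h : p ≡ suc (h ℕ.+ h)) where
  open ModPrime p p-prime
  open Int using (_+_; _*_; _-_; -_)

  0<h : 0 ℕ.< h
  0<h = positive h p≡1+2h
    where positive : ∀ k → p ≡ suc (k ℕ.+ k) → 0 ℕ.< k
          positive zero p≡1 = ⊥-elim (ℕP.<⇒≢ 1<p (sym p≡1))
          positive (suc _) _ = s≤s z≤n

  half : Fin h → ℤ
  half j = + suc (toℕ j)

  half<p : ∀ j → suc (toℕ j) ℕ.< p
  half<p j = subst (suc (toℕ j) ℕ.<_) (sym p≡1+2h) (s≤s (ℕP.m≤n⇒m≤n+o h (FinP.toℕ<n j)))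

  half-unit : ∀ j → Unit (half j)
  half-unit j = small⇒unit (s≤s z≤n) (half<p j)

  half²-injective : ∀ {c} j k → Unit c → P ∣ c * (half j * half j) - c * (half k * half k) → j ≡ k
  half²-injective {c} j k uc p∣diff = roots-equal (p∣xy⇒p∣x⊎p∣y (half j - half k) (half j + half k) p∣j²-k²)
    where
      factor : ∀ c a b → c * ((a - b) * (a + b)) ≡ c * (a * a) - c * (b * b)
      factor = solve-∀
      p∣j²-k² : P ∣ (half j - half k) * (half j + half k)
      p∣j²-k² = unit-cancel uc (∣-resp-≡ (factor c (half j) (half k)) p∣diff)
      roots-equal : P ∣ half j - half k ⊎ P ∣ half j + half k → j ≡ k
      roots-equal (inj₁ p∣j-k) = FinP.toℕ-injective (ℕP.suc-injective (∣-small⇒≡ (half<p j) (half<p k) p∣j-k))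
      roots-equal (inj₂ p∣j+k) = ⊥-elim (small⇒unit (s≤s z≤n) j+k<p p∣j+k)
        where j+k<p : suc (toℕ j) ℕ.+ suc (toℕ k) ℕ.< p
              j+k<p = subst (suc (toℕ j) ℕ.+ suc (toℕ k) ℕ.<_) (sym p≡1+2h)
                            (s≤s (ℕP.+-mono-≤ (FinP.toℕ<n j) (FinP.toℕ<n k)))

  unit⇒%≢0 : ∀ {z} → Unit z → z ℤDM.% P ≢ 0
  unit⇒%≢0 {z} uz r≡0 = uz (divides (z ℤDM./ P)
    (trans (ℤDM.a≡a%n+[a/n]*n z P) (trans (cong (λ r → + r + z ℤDM./ P * P) r≡0) (ℤP.+-identityˡ _))))

  pred[%]<2h : ∀ {z} → Unit z → ℕ.pred (z ℤDM.% P) ℕ.< h ℕ.+ h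
  pred[%]<2h {z} uz = subst (ℕ.pred (z ℤDM.% P) ℕ.<_) (cong ℕ.pred p≡1+2h)
                            (ℕP.pred-mono-< {{ℕ.≢-nonZero (unit⇒%≢0 uz)}} (ℤDM.n%d<d z P))

  -- A unit is coded by its residue in 1, …, p - 1, shifted down to Fin (p - 1).
  residue : ∀ z → Unit z → Fin (h ℕ.+ h)
  residue z uz = fromℕ< (pred[%]<2h uz)

  residue-injective : ∀ {z z'} uz uz' → residue z uz ≡ residue z' uz' → P ∣ z - z'
  residue-injective {z} {z'} uz uz' eq = divides (q - q') (begin
      z - z'                          ≡⟨ cong₂ _-_ (ℤDM.a≡a%n+[a/n]*n z P) (ℤDM.a≡a%n+[a/n]*n z' P) ⟩
      + r + q * P - (+ r' + q' * P)   ≡⟨ cong (λ t → + t + q * P - (+ r' + q' * P)) r≡r' ⟩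
      + r' + q * P - (+ r' + q' * P)  ≡⟨ cancel (+ r') q q' P ⟩
      (q - q') * P                    ∎)
    where
      open ≡-Reasoning
      r = z ℤDM.% P
      r' = z' ℤDM.% P
      q = z ℤDM./ P
      q' = z' ℤDM./ P
      r≡r' : r ≡ r'
      r≡r' = begin
        r                      ≡⟨ sym (ℕP.suc-pred r {{ℕ.≢-nonZero (unit⇒%≢0 uz)}}) ⟩
        suc (ℕ.pred r)         ≡⟨ cong suc (trans (sym (FinP.toℕ-fromℕ< _))
                                                 (trans (cong toℕ eq) (FinP.toℕ-fromℕ< _))) ⟩
        suc (ℕ.pred r')        ≡⟨ ℕP.suc-pred r' {{ℕ.≢-nonZero (unit⇒%≢0 uz')}} ⟩
        r'                     ∎
      cancel : ∀ r q q' P → r + q * P - (r + q' * P) ≡ (q - q') * P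
      cancel = solve-∀

  -- If a, b and ab were all non-squares, the 3(p-1)/2 numbers j², a j², b j² (1 ≤ j ≤ (p-1)/2)
  -- would be pairwise incongruent units.
  nonsquare*nonsquare⇒square : ∀ {a b} → Unit a → ¬ Square a → Unit b → ¬ Square b → Square (a * b)
  nonsquare*nonsquare⇒square {a} {b} ua ¬□a ub ¬□b with square? (a * b)
  ... | yes □ab = □ab
  ... | no ¬□ab = ⊥-elim (ℕP.<⇒≱ 2h<3h (FinP.injective⇒≤ class-injective))
    where
      coset : Fin 3 → ℤ
      coset 0F = + 1
      coset 1F = a
      coset 2F = b

      coset-unit : ∀ c → Unit (coset c)
      coset-unit 0F = unit-1
      coset-unit 1F = ua
      coset-unit 2F = ub

      cosets-distinct : ∀ c c' → c ≢ c' → ¬ Square (coset c * coset c')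
      cosets-distinct 0F 0F c≢c' = ⊥-elim (c≢c' refl)
      cosets-distinct 0F 1F _ = ¬□a ∘ subst Square (ℤP.*-identityˡ a)
      cosets-distinct 0F 2F _ = ¬□b ∘ subst Square (ℤP.*-identityˡ b)
      cosets-distinct 1F 0F _ = ¬□a ∘ subst Square (ℤP.*-identityʳ a)
      cosets-distinct 1F 1F c≢c' = ⊥-elim (c≢c' refl)
      cosets-distinct 1F 2F _ = ¬□ab
      cosets-distinct 2F 0F _ = ¬□b ∘ subst Square (ℤP.*-identityʳ b)
      cosets-distinct 2F 1F _ = ¬□ab ∘ subst Square (ℤP.*-comm b a)
      cosets-distinct 2F 2F c≢c' = ⊥-elim (c≢c' refl)

      value : Fin 3 × Fin h → ℤ
      value (c , j) = coset c * (half j * half j)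

      value-unit : ∀ x → Unit (value x)
      value-unit (c , j) = unit-* (coset-unit c) (unit-* (half-unit j) (half-unit j))

      value-injective : ∀ x y → P ∣ value x - value y → x ≡ y
      value-injective (c , j) (c' , k) p∣diff with c FinP.≟ c'
      ... | yes refl = cong (c ,_) (half²-injective j k (coset-unit c) p∣diff)
      ... | no c≢c' = ⊥-elim (cosets-distinct c c' c≢c'
                               (square-product (coset c) (coset c') (half j) (half k) (half-unit j) p∣diff))

      index : Fin (3 ℕ.* h) → Fin 3 × Fin h
      index = Fin.remQuot {3} h

      class : Fin (3 ℕ.* h) → Fin (h ℕ.+ h)
      class i = residue (value (index i)) (value-unit (index i))

      class-injective : ∀ {i j} → class i ≡ class j → i ≡ j
      class-injective {i} {j} eq = remQuot-injective {3} h
        (value-injective (index i) (index j) (residue-injective (value-unit (index i)) (value-unit (index j)) eq))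

      2h<3h : h ℕ.+ h ℕ.< 3 ℕ.* h
      2h<3h = subst (h ℕ.+ h ℕ.<_) (triple h) (ℕP.m<m+n (h ℕ.+ h) 0<h)
        where triple : ∀ h → h ℕ.+ h ℕ.+ h ≡ 3 ℕ.* h
              triple = ℕSolver.solve-∀

module Isotropy (p : ℕ) (p-prime : Prime p) (h : ℕ) (p≡1+2h : p ≡ suc (h ℕ.+ h)) where
  open ModPrime p p-prime
  open Int using (_+_; _*_; _-_; -_)
  open QuadraticCharacter p p-prime h p≡1+2h

  NonsquareAfterSquare : ℤ → Set
  NonsquareAfterSquare n₀ = Unit n₀ × ¬ Square n₀ × Unit (n₀ - + 1) × Square (n₀ - + 1)

  descend-to-square : ∀ r → suc r ℕ.< p → ¬ Square (+ suc r) → ∃ NonsquareAfterSquare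
  descend-to-square zero _ ¬□1 = ⊥-elim (¬□1 square-1)
  descend-to-square (suc r) r+2<p ¬□ with square? (+ suc r)
  ... | yes □ = + suc (suc r) , small⇒unit (s≤s z≤n) r+2<p , ¬□ ,
                small⇒unit (s≤s z≤n) (ℕP.<-trans (ℕP.n<1+n (suc r)) r+2<p) , □
  ... | no ¬□' = descend-to-square r (ℕP.<-trans (ℕP.n<1+n (suc r)) r+2<p) ¬□'

  nonsquare⇒nonsquareAfterSquare : ∀ {ν} → Unit ν → ¬ Square ν → ∃ NonsquareAfterSquare
  nonsquare⇒nonsquareAfterSquare {ν} uν ¬□ν = from-residue (ν ℤDM.% P) (ℤDM.n%d<d ν P) ¬□[ν%p]
    where
      open ≡-Reasoning
      cancel : ∀ r q P → r - (r + q * P) ≡ - q * P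
      cancel = solve-∀
      ¬□[ν%p] : ¬ Square (+ (ν ℤDM.% P))
      ¬□[ν%p] □ = ¬□ν (square-cong □ (divides (- (ν ℤDM./ P)) (begin
        + (ν ℤDM.% P) - ν
          ≡⟨ cong (λ t → + (ν ℤDM.% P) - t) (ℤDM.a≡a%n+[a/n]*n ν P) ⟩
        + (ν ℤDM.% P) - (+ (ν ℤDM.% P) + ν ℤDM./ P * P)
          ≡⟨ cancel (+ (ν ℤDM.% P)) (ν ℤDM./ P) P ⟩
        - (ν ℤDM./ P) * P ∎)))
      from-residue : ∀ r → r ℕ.< p → ¬ Square (+ r) → ∃ NonsquareAfterSquare
      from-residue zero _ ¬□0 = ⊥-elim (¬□0 (square-intro (+ 0) (+ 0) (divides (+ 0) refl)))
      from-residue (suc r) = descend-to-square r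

  Isotropic₂ : ℤ → ℤ → Set
  Isotropic₂ u v = ∃₂ λ c d → Unit c × Unit d × P ∣ c * c * u + d * d * v

  Isotropic₃ : ℤ → ℤ → ℤ → Set
  Isotropic₃ u v w = ∃₂ λ c d → ∃ λ e → Unit c × Unit d × Unit e × P ∣ c * c * u + d * d * v + e * e * w

  square[-uv]⇒isotropic₂ : ∀ {u v} → Unit u → Unit v → Square (- (u * v)) → Isotropic₂ u v
  square[-uv]⇒isotropic₂ {u} {v} uu uv □ with square-root □
  ... | σ , p∣σ²+uv = σ , u , unit-root σ p∣σ²+uv (unit-neg (unit-* uu uv)) , uu ,
                      ∣-resp-≡ (factor σ u v) (∣n⇒∣m*n u p∣σ²+uv)
    where factor : ∀ σ u v → σ * σ * u + u * u * v ≡ u * (σ * σ - - (u * v))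
          factor = solve-∀

  -- The weights (vwta, uvwn₀, rt) give c²u + d²v + e²w ≡ u²v³w²(-n₀(n₀ - 1) + n₀² - n₀) = 0.
  isotropic₃-witness : ∀ {u v w n₀} → Unit u → Unit v → Unit w → Unit n₀ → Unit (n₀ - + 1) →
                       (∃ λ a → P ∣ a * a - (n₀ - + 1)) → (∃ λ t → P ∣ t * t - - (u * v) * n₀) →
                       (∃ λ r → P ∣ r * r - - (u * v) * - (v * w)) → Isotropic₃ u v w
  isotropic₃-witness {u} {v} {w} {n₀} uu uv uw un₀ un₀-1 (a , p∣a²) (t , p∣t²) (r , p∣r²) =
      v * w * t * a , u * v * w * n₀ , r * t ,
      unit-* (unit-* (unit-* uv uw) ut) ua , unit-* (unit-* (unit-* uu uv) uw) un₀ , unit-* ur ut ,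
      ∣-resp-≡ (identity u v w t a r n₀)
        (∣m∣n⇒∣m+n (∣m∣n⇒∣m+n (∣n⇒∣m*n (u * v * v * w * w * n₀) p∣t²)
                               (∣n⇒∣m*n (u * v * v * w * w * t * t) p∣a²))
                   (∣n⇒∣m*n (t * t * w) p∣r²))
    where
      ut = unit-root t p∣t² (unit-* (unit-neg (unit-* uu uv)) un₀)
      ua = unit-root a p∣a² un₀-1
      ur = unit-root r p∣r² (unit-* (unit-neg (unit-* uu uv)) (unit-neg (unit-* uv uw)))
      identity : ∀ u v w t a r n₀ →
        v * w * t * a * (v * w * t * a) * u + u * v * w * n₀ * (u * v * w * n₀) * v + r * t * (r * t) * w
        ≡ u * v * v * w * w * n₀ * (t * t - - (u * v) * n₀) + u * v * v * w * w * t * t * (a * a - (n₀ - + 1))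
          + t * t * w * (r * r - - (u * v) * - (v * w))
      identity = solve-∀

  -- With n₀ a non-square and n₀ - 1 a square, both -uv·n₀ and (-uv)(-vw) are squares.
  nonsquares⇒isotropic₃ : ∀ {u v w} → Unit u → Unit v → Unit w →
                          ¬ Square (- (u * v)) → ¬ Square (- (v * w)) → Isotropic₃ u v w
  nonsquares⇒isotropic₃ uu uv uw ¬□uv ¬□vw =
    let n₀ , un₀ , ¬□n₀ , un₀-1 , □n₀-1 = nonsquare⇒nonsquareAfterSquare u[-uv] ¬□uv
    in isotropic₃-witness uu uv uw un₀ un₀-1
         (square-root □n₀-1)
         (square-root (nonsquare*nonsquare⇒square u[-uv] ¬□uv un₀ ¬□n₀))
         (square-root (nonsquare*nonsquare⇒square u[-uv] ¬□uv (unit-neg (unit-* uv uw)) ¬□vw))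
    where u[-uv] = unit-neg (unit-* uu uv)

  isotropic-units : ∀ {u v w} → Unit u → Unit v → Unit w → Isotropic₂ u v ⊎ Isotropic₂ v w ⊎ Isotropic₃ u v w
  isotropic-units {u} {v} {w} uu uv uw with square? (- (u * v)) | square? (- (v * w))
  ... | yes □uv | _ = inj₁ (square[-uv]⇒isotropic₂ uu uv □uv)
  ... | no _ | yes □vw = inj₂ (inj₁ (square[-uv]⇒isotropic₂ uv uw □vw))
  ... | no ¬□uv | no ¬□vw = inj₂ (inj₂ (nonsquares⇒isotropic₃ uu uv uw ¬□uv ¬□vw))

-- Zero sums modulo p²

module ModPrimeSquare (p : ℕ) (p-prime : Prime p) (h : ℕ) (p≡1+2h : p ≡ suc (h ℕ.+ h)) where
  open ModPrime p p-prime
  open Int using (_+_; _*_; _-_; -_)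
  open QuadraticCharacter p p-prime h p≡1+2h using (0<h)
  open Isotropy p p-prime h p≡1+2h

  ZeroSumMod : ℤ → List ℤ → Set
  ZeroSumMod M xs = ∃ λ cs → length cs ≡ length xs × All Unit cs × M ∣ sqWeightedSum cs xs

  P² : ℤ
  P² = P * P

  HasZeroSegment : List ℤ → Set
  HasZeroSegment xs = ∃₂ λ pre seg → ∃ λ suf → xs ≡ pre ++ seg ++ suf × 1 ℕ.≤ length seg × ZeroSumMod P² seg

  zeroSegment-++ˡ : ∀ pre {xs} → HasZeroSegment xs → HasZeroSegment (pre ++ xs)
  zeroSegment-++ˡ pre (pre' , seg , suf , xs≡ , 1≤ , zs) =
    pre ++ pre' , seg , suf , trans (cong (pre ++_) xs≡) (sym (++-assoc pre pre' _)) , 1≤ , zs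

  zeroSegment-prefix : ∀ {x seg} suf → ZeroSumMod P² (x ∷ seg) → HasZeroSegment (x ∷ seg ++ suf)
  zeroSegment-prefix {x} {seg} suf zs = [] , x ∷ seg , suf , refl , s≤s z≤n , zs

  isotropic₂⇒zeroSum : ∀ {u v} → Isotropic₂ u v → ZeroSumMod P (u ∷ v ∷ [])
  isotropic₂⇒zeroSum {u} {v} (c , d , uc , ud , p∣) =
    c ∷ d ∷ [] , refl , uc ∷ ud ∷ [] , ∣-resp-≡ (unfold (c * c * u) (d * d * v)) p∣
    where unfold : ∀ a b → a + (b + + 0) ≡ a + b
          unfold = solve-∀

  isotropic₃⇒zeroSum : ∀ {u v w} → Isotropic₃ u v w → ZeroSumMod P (u ∷ v ∷ w ∷ [])
  isotropic₃⇒zeroSum {u} {v} {w} (c , d , e , uc , ud , ue , p∣) =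
    c ∷ d ∷ e ∷ [] , refl , uc ∷ ud ∷ ue ∷ [] , ∣-resp-≡ (unfold (c * c * u) (d * d * v) (e * e * w)) p∣
    where unfold : ∀ a b c → a + (b + (c + + 0)) ≡ a + b + c
          unfold = solve-∀

  zeroSum-scale : ∀ {zs} → ZeroSumMod P zs → ZeroSumMod P² (map (_* P) zs)
  zeroSum-scale {zs} (cs , len , ucs , p∣) =
    cs , trans len (sym (length-map (_* P) zs)) , ucs ,
    subst (P² ∣_) (sym (sqWeightedSum-*ʳ cs zs P)) (*-monoˡ-∣ P p∣)

  zeroSum-insert : ∀ pre {a ys} → All (P ∣_) a → ZeroSumMod P (pre ++ ys) → ZeroSumMod P (pre ++ a ++ ys)
  zeroSum-insert pre {a} {ys} p∣a (cs , len , ucs , p∣) =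
    padWeights pre a cs , pad-length pre cs len , pad-unit pre ucs ,
    ∣-resp-≡ (pad-sum pre cs len) (∣m∣n⇒∣m+n (ones-sum p∣a) p∣)
    where
      ones : List ℤ → List ℤ
      ones = map (λ _ → + 1)

      padWeights : List ℤ → List ℤ → List ℤ → List ℤ
      padWeights [] a cs = ones a ++ cs
      padWeights (_ ∷ _) a [] = []
      padWeights (_ ∷ pre) a (c ∷ cs) = c ∷ padWeights pre a cs

      ones-length : ∀ a → length (ones a) ≡ length a
      ones-length = length-map _

      ones-sum : ∀ {a} → All (P ∣_) a → P ∣ sqWeightedSum (ones a) a
      ones-sum [] = divides (+ 0) refl
      ones-sum (p∣x ∷ p∣a) = ∣m∣n⇒∣m+n (∣n⇒∣m*n (+ 1 * + 1) p∣x) (ones-sum p∣a)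

      pad-length : ∀ pre cs → length cs ≡ length (pre ++ ys) → length (padWeights pre a cs) ≡ length (pre ++ a ++ ys)
      pad-length [] cs len = trans (length-++ (ones a)) (trans (cong₂ ℕ._+_ (ones-length a) len) (sym (length-++ a)))
      pad-length (_ ∷ pre) (c ∷ cs) len = cong suc (pad-length pre cs (ℕP.suc-injective len))

      pad-unit : ∀ pre {cs} → All Unit cs → All Unit (padWeights pre a cs)
      pad-unit [] ucs = AllP.++⁺ (ones-unit a) ucs
        where ones-unit : ∀ a → All Unit (ones a)
              ones-unit [] = []
              ones-unit (_ ∷ a) = unit-1 ∷ ones-unit a
      pad-unit (_ ∷ pre) [] = []
      pad-unit (_ ∷ pre) (uc ∷ ucs) = uc ∷ pad-unit pre ucs

      pad-sum : ∀ pre cs → length cs ≡ length (pre ++ ys) →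
                sqWeightedSum (padWeights pre a cs) (pre ++ a ++ ys) ≡ sqWeightedSum (ones a) a + sqWeightedSum cs (pre ++ ys)
      pad-sum [] cs _ = sqWeightedSum-++ (ones a) a (ones-length a)
      pad-sum (x ∷ pre) (c ∷ cs) len = trans (cong (λ s → c * c * x + s) (pad-sum pre cs (ℕP.suc-injective len)))
                                             (swap (c * c * x) (sqWeightedSum (ones a) a) (sqWeightedSum cs (pre ++ ys)))
        where swap : ∀ a b c → a + (b + c) ≡ b + (a + c)
              swap = solve-∀

  unit-2 : Unit (+ 2)
  unit-2 = small⇒unit (s≤s z≤n) (subst (2 ℕ.<_) (sym p≡1+2h) (s≤s (ℕP.+-mono-≤ 0<h 0<h)))

  -- Hensel's lemma for c ↦ c²u + S, with ι an inverse of the derivative 2cu modulo p.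
  hensel : ∀ {c u S k ι} → c * c * u + S ≡ k * P → P ∣ ι * (+ 2 * c * u) - + 1 →
           P² ∣ (c + (- k * ι) * P) * (c + (- k * ι) * P) * u + S
  hensel {c} {u} {S} {k} {ι} c²u+S≡kP (divides m ι2cu-1≡mP) = ∣-resp-≡ (expand c u S k ι P)
    (∣m∣n⇒∣m+n (∣m∣n⇒∣m+n (divides (+ 0) (trans (cong (_- k * P) c²u+S≡kP) (cancel k P)))
                           (divides (- k * m) (trans (cong ((- k * P) *_) ι2cu-1≡mP) (regroup k m P))))
               (∣n⇒∣m*n ((- k * ι) * (- k * ι) * u) ∣-refl))
    where
      expand : ∀ c u S k ι P → (c + (- k * ι) * P) * (c + (- k * ι) * P) * u + S
               ≡ (c * c * u + S - k * P) + (- k * P) * (ι * (+ 2 * c * u) - + 1) + (- k * ι) * (- k * ι) * u * (P * P)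
      expand = solve-∀
      cancel : ∀ k P → k * P - k * P ≡ + 0 * (P * P)
      cancel = solve-∀
      regroup : ∀ k m P → (- k * P) * (m * P) ≡ (- k * m) * (P * P)
      regroup = solve-∀

  zeroSum-lift : ∀ {u xs} → Unit u → ZeroSumMod P (u ∷ xs) → ZeroSumMod P² (u ∷ xs)
  zeroSum-lift {u} {xs} uu (c ∷ cs , len , uc ∷ ucs , divides k c²u+S≡kP) =
    c + (- k * ι) * P ∷ cs , len , unit-cong (divides (k * ι) (shift c k ι P)) uc ∷ ucs ,
    hensel {c} {u} {sqWeightedSum cs xs} {k} {ι} c²u+S≡kP ι2cu≡1
    where
      inverse = unit⇒invertible (unit-* (unit-* unit-2 uc) uu)
      ι = proj₁ inverse
      ι2cu≡1 = proj₂ inverse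
      shift : ∀ c k ι P → c - (c + (- k * ι) * P) ≡ k * ι * P
      shift = solve-∀

  classify : ∀ x → P² ∣ x ⊎ Unit x ⊎ ∃ λ z → x ≡ z * P × Unit z
  classify x with P ∣? x
  ... | no ux = inj₂ (inj₁ ux)
  ... | yes (divides z x≡zP) with P ∣? z
  ...   | yes (divides w z≡wP) = inj₁ (divides w (trans x≡zP (trans (cong (_* P) z≡wP) (ℤP.*-assoc w P P))))
  ...   | no uz = inj₂ (inj₂ (z , x≡zP , uz))

  zeroSum-single : ∀ {x} → P² ∣ x → ZeroSumMod P² [ x ]
  zeroSum-single {x} p²∣x = [ + 1 ] , refl , unit-1 ∷ [] , ∣-resp-≡ (unit-weight x) p²∣x
    where unit-weight : ∀ x → + 1 * + 1 * x + + 0 ≡ x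
          unit-weight = solve-∀

  zeroSegment-multiples : ∀ {z₁ z₂ z₃} rest → Unit z₁ → Unit z₂ → Unit z₃ →
                          HasZeroSegment (z₁ * P ∷ z₂ * P ∷ z₃ * P ∷ rest)
  zeroSegment-multiples {z₁} {z₂} {z₃} rest uz₁ uz₂ uz₃ with isotropic-units uz₁ uz₂ uz₃
  ... | inj₁ iso = zeroSegment-prefix (z₃ * P ∷ rest) (zeroSum-scale (isotropic₂⇒zeroSum iso))
  ... | inj₂ (inj₁ iso) = zeroSegment-++ˡ [ z₁ * P ] (zeroSegment-prefix rest (zeroSum-scale (isotropic₂⇒zeroSum iso)))
  ... | inj₂ (inj₂ iso) = zeroSegment-prefix rest (zeroSum-scale (isotropic₃⇒zeroSum iso))

  zeroSegment-units : ∀ {u₁ u₂ u₃} a₂ a₃ rest → All (P ∣_) a₂ → All (P ∣_) a₃ →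
                      Unit u₁ → Unit u₂ → Unit u₃ → HasZeroSegment (u₁ ∷ a₂ ++ u₂ ∷ a₃ ++ u₃ ∷ rest)
  zeroSegment-units {u₁} {u₂} {u₃} a₂ a₃ rest p∣a₂ p∣a₃ uu₁ uu₂ uu₃ with isotropic-units uu₁ uu₂ uu₃
  ... | inj₁ iso = subst HasZeroSegment (cong (u₁ ∷_) (++-assoc a₂ [ u₂ ] _))
        (zeroSegment-prefix (a₃ ++ u₃ ∷ rest)
          (zeroSum-lift uu₁ (zeroSum-insert [ u₁ ] p∣a₂ (isotropic₂⇒zeroSum iso))))
  ... | inj₂ (inj₁ iso) = zeroSegment-++ˡ (u₁ ∷ a₂)
        (subst HasZeroSegment (cong (u₂ ∷_) (++-assoc a₃ [ u₃ ] rest))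
          (zeroSegment-prefix rest (zeroSum-lift uu₂ (zeroSum-insert [ u₂ ] p∣a₃ (isotropic₂⇒zeroSum iso)))))
  ... | inj₂ (inj₂ iso) = subst HasZeroSegment
        (cong (u₁ ∷_) (trans (++-assoc a₂ (u₂ ∷ a₃ ++ [ u₃ ]) rest)
                             (cong (λ t → a₂ ++ u₂ ∷ t) (++-assoc a₃ [ u₃ ] rest))))
        (zeroSegment-prefix rest (zeroSum-lift uu₁
          (zeroSum-insert [ u₁ ] p∣a₂ (zeroSum-insert (u₁ ∷ u₂ ∷ []) p∣a₃ (isotropic₃⇒zeroSum iso)))))

  UnitAfterMultiples : List ℤ → Set
  UnitAfterMultiples xs = ∃₂ λ a u → ∃ λ rest → xs ≡ a ++ u ∷ rest × All (P ∣_) a × Unit u × length a ℕ.≤ 2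

  zeroSegment⊎unit : ∀ xs → 3 ℕ.≤ length xs → HasZeroSegment xs ⊎ UnitAfterMultiples xs
  zeroSegment⊎unit (x₁ ∷ x₂ ∷ x₃ ∷ rest) _ with classify x₁ | classify x₂ | classify x₃
  ... | inj₁ p²∣x₁ | _ | _ = inj₁ (zeroSegment-prefix (x₂ ∷ x₃ ∷ rest) (zeroSum-single p²∣x₁))
  ... | inj₂ (inj₁ ux₁) | _ | _ = inj₂ ([] , x₁ , x₂ ∷ x₃ ∷ rest , refl , [] , ux₁ , z≤n)
  ... | inj₂ (inj₂ _) | inj₁ p²∣x₂ | _ =
        inj₁ (zeroSegment-++ˡ [ x₁ ] (zeroSegment-prefix (x₃ ∷ rest) (zeroSum-single p²∣x₂)))
  ... | inj₂ (inj₂ (z₁ , x₁≡ , _)) | inj₂ (inj₁ ux₂) | _ =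
        inj₂ ([ x₁ ] , x₂ , x₃ ∷ rest , refl , divides z₁ x₁≡ ∷ [] , ux₂ , s≤s z≤n)
  ... | inj₂ (inj₂ _) | inj₂ (inj₂ _) | inj₁ p²∣x₃ =
        inj₁ (zeroSegment-++ˡ (x₁ ∷ x₂ ∷ []) (zeroSegment-prefix rest (zeroSum-single p²∣x₃)))
  ... | inj₂ (inj₂ (z₁ , x₁≡ , _)) | inj₂ (inj₂ (z₂ , x₂≡ , _)) | inj₂ (inj₁ ux₃) =
        inj₂ (x₁ ∷ x₂ ∷ [] , x₃ , rest , refl , divides z₁ x₁≡ ∷ divides z₂ x₂≡ ∷ [] , ux₃ , s≤s (s≤s z≤n))
  ... | inj₂ (inj₂ (z₁ , refl , uz₁)) | inj₂ (inj₂ (z₂ , refl , uz₂)) | inj₂ (inj₂ (z₃ , refl , uz₃)) =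
        inj₁ (zeroSegment-multiples rest uz₁ uz₂ uz₃)
  zeroSegment⊎unit (_ ∷ []) (s≤s ())
  zeroSegment⊎unit (_ ∷ _ ∷ []) (s≤s (s≤s ()))


  length-rest : ∀ k a (u : ℤ) rest → k ℕ.+ 3 ℕ.≤ length (a ++ u ∷ rest) → length a ℕ.≤ 2 →
                k ℕ.≤ length rest
  length-rest k a u rest k+3≤ |a|≤2 = ℕP.+-cancelʳ-≤ 3 k (length rest) (begin
    k ℕ.+ 3                        ≤⟨ k+3≤ ⟩
    length (a ++ u ∷ rest)         ≡⟨ length-++ a ⟩
    length a ℕ.+ suc (length rest) ≤⟨ ℕP.+-monoˡ-≤ (suc (length rest)) |a|≤2 ⟩
    3 ℕ.+ length rest              ≡⟨ ℕP.+-comm 3 (length rest) ⟩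
    length rest ℕ.+ 3              ∎)
    where open ℕP.≤-Reasoning

  nine⇒zeroSegment : ∀ xs → 9 ℕ.≤ length xs → HasZeroSegment xs
  nine⇒zeroSegment xs 9≤ with zeroSegment⊎unit xs (ℕP.≤-trans (ℕP.m≤n+m 3 6) 9≤)
  ... | inj₁ has = has
  ... | inj₂ (a₁ , u₁ , r₁ , refl , _ , uu₁ , |a₁|≤2)
    with 6≤ ← length-rest 6 a₁ u₁ r₁ 9≤ |a₁|≤2
    with zeroSegment⊎unit r₁ (ℕP.≤-trans (ℕP.m≤n+m 3 3) 6≤)
  ... | inj₁ has = zeroSegment-++ˡ a₁ (zeroSegment-++ˡ [ u₁ ] has)
  ... | inj₂ (a₂ , u₂ , r₂ , refl , p∣a₂ , uu₂ , |a₂|≤2)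
    with zeroSegment⊎unit r₂ (length-rest 3 a₂ u₂ r₂ 6≤ |a₂|≤2)
  ... | inj₁ has = zeroSegment-++ˡ a₁ (zeroSegment-++ˡ (u₁ ∷ a₂) (zeroSegment-++ˡ [ u₂ ] has))
  ... | inj₂ (a₃ , u₃ , r₃ , refl , p∣a₃ , uu₃ , _) =
        zeroSegment-++ˡ a₁ (zeroSegment-units a₂ a₃ r₃ p∣a₂ p∣a₃ uu₁ uu₂ uu₃)

-- From integers to ℤ_n

map-≡-++⁻ : ∀ {A B : Set} (f : A → B) xs ys {zs} → map f xs ≡ ys ++ zs →
            ∃₂ λ xs₁ xs₂ → xs ≡ xs₁ ++ xs₂ × map f xs₁ ≡ ys × map f xs₂ ≡ zs
map-≡-++⁻ f xs [] eq = [] , xs , refl , refl , eq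
map-≡-++⁻ f (x ∷ xs) (y ∷ ys) eq with map-≡-++⁻ f xs ys (proj₂ (∷-injective eq))
... | xs₁ , xs₂ , xs≡ , eq₁ , eq₂ =
      x ∷ xs₁ , xs₂ , cong (x ∷_) xs≡ , cong₂ _∷_ (proj₁ (∷-injective eq)) eq₁ , eq₂

module Transfer (n m' p h : ℕ) (p-prime : Prime p) (p≡1+2h : p ≡ suc (h ℕ.+ h))
                (n≡[m'p]² : n ≡ (m' ℕ.* p) ℕ.* (m' ℕ.* p)) {{_ : NonZero n}} {{_ : NonZero m'}} where
  open ModPrime p p-prime using (P; Unit)
  open ModPrimeSquare p p-prime h p≡1+2h using (P²; nine⇒zeroSegment)
  open Int using (_+_; _*_; _-_; -_)

  rep : Fin n → ℤ
  rep x = + toℕ x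

  m'k² : ℕ → ℕ
  m'k² k = (m' ℕ.* k) ℕ.* (m' ℕ.* k)

  -- An integer weight c prime to p becomes the weight (m'c)² in ℤ_n.
  weight : ℤ → Fin n
  weight c = fromℕ< (m%n<n (m'k² (abs c)) n)

  absSqWeightedSum : List ℤ → List (Fin n) → ℕ
  absSqWeightedSum (c ∷ cs) (x ∷ xs) = abs c ℕ.* abs c ℕ.* toℕ x ℕ.+ absSqWeightedSum cs xs
  absSqWeightedSum _ _ = 0

  sqWeightedSum-rep : ∀ cs xs → sqWeightedSum cs (map rep xs) ≡ + absSqWeightedSum cs xs
  sqWeightedSum-rep [] xs = refl
  sqWeightedSum-rep (c ∷ cs) [] = refl
  sqWeightedSum-rep (c ∷ cs) (x ∷ xs) = begin
      c * c * + toℕ x + sqWeightedSum cs (map rep xs)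
        ≡⟨ cong₂ (λ a b → a * + toℕ x + b) (x*x≡+abs[x]*abs[x] c) (sqWeightedSum-rep cs xs) ⟩
      + (abs c ℕ.* abs c) * + toℕ x + + absSqWeightedSum cs xs
        ≡⟨ cong (_+ + absSqWeightedSum cs xs) (sym (ℤP.pos-* (abs c ℕ.* abs c) (toℕ x))) ⟩
      + (abs c ℕ.* abs c ℕ.* toℕ x) + + absSqWeightedSum cs xs
        ≡⟨ sym (ℤP.pos-+ _ (absSqWeightedSum cs xs)) ⟩
      + absSqWeightedSum (c ∷ cs) (x ∷ xs) ∎
    where open ≡-Reasoning

  m'²*absSqWeightedSum : ∀ cs xs → ∃ λ K →
                         (m' ℕ.* m') ℕ.* absSqWeightedSum cs xs ≡ weightedSum (map weight cs) xs ℕ.+ K ℕ.* n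
  m'²*absSqWeightedSum [] xs = 0 , ℕP.*-zeroʳ (m' ℕ.* m')
  m'²*absSqWeightedSum (c ∷ cs) [] = 0 , ℕP.*-zeroʳ (m' ℕ.* m')
  m'²*absSqWeightedSum (c ∷ cs) (x ∷ xs) with m'²*absSqWeightedSum cs xs
  ... | K , eq = m'k² k / n ℕ.* toℕ x ℕ.+ K , (begin
      (m' ℕ.* m') ℕ.* (k ℕ.* k ℕ.* toℕ x ℕ.+ absSqWeightedSum cs xs)
        ≡⟨ distrib m' k (toℕ x) (absSqWeightedSum cs xs) ⟩
      m'k² k ℕ.* toℕ x ℕ.+ (m' ℕ.* m') ℕ.* absSqWeightedSum cs xs
        ≡⟨ cong₂ (λ a b → a ℕ.* toℕ x ℕ.+ b) (m≡m%n+[m/n]*n (m'k² k) n) eq ⟩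
      (m'k² k % n ℕ.+ m'k² k / n ℕ.* n) ℕ.* toℕ x ℕ.+ (weightedSum (map weight cs) xs ℕ.+ K ℕ.* n)
        ≡⟨ regroup (m'k² k % n) (m'k² k / n) n (toℕ x) (weightedSum (map weight cs) xs) K ⟩
      m'k² k % n ℕ.* toℕ x ℕ.+ weightedSum (map weight cs) xs ℕ.+ (m'k² k / n ℕ.* toℕ x ℕ.+ K) ℕ.* n
        ≡⟨ cong (λ w → w ℕ.* toℕ x ℕ.+ weightedSum (map weight cs) xs ℕ.+ (m'k² k / n ℕ.* toℕ x ℕ.+ K) ℕ.* n)
                (sym (FinP.toℕ-fromℕ< (m%n<n (m'k² k) n))) ⟩
      toℕ (weight c) ℕ.* toℕ x ℕ.+ weightedSum (map weight cs) xs ℕ.+ (m'k² k / n ℕ.* toℕ x ℕ.+ K) ℕ.* n ∎)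
    where
      open ≡-Reasoning
      k = abs c
      distrib : ∀ m k x s → (m ℕ.* m) ℕ.* (k ℕ.* k ℕ.* x ℕ.+ s)
                            ≡ (m ℕ.* k) ℕ.* (m ℕ.* k) ℕ.* x ℕ.+ (m ℕ.* m) ℕ.* s
      distrib = ℕSolver.solve-∀
      regroup : ∀ r d n x w K → (r ℕ.+ d ℕ.* n) ℕ.* x ℕ.+ (w ℕ.+ K ℕ.* n)
                              ≡ r ℕ.* x ℕ.+ w ℕ.+ (d ℕ.* x ℕ.+ K) ℕ.* n
      regroup = ℕSolver.solve-∀

  [m'p]²≡m'²p² : ∀ m p → (m ℕ.* p) ℕ.* (m ℕ.* p) ≡ (m ℕ.* m) ℕ.* (p ℕ.* p)
  [m'p]²≡m'²p² = ℕSolver.solve-∀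

  n∣m'k²⇒p∣k : ∀ k → n ℕD.∣ m'k² k → p ℕD.∣ k
  n∣m'k²⇒p∣k k n∣ = [ id , id ]′ (euclidsLemma k k p-prime (ℕD.∣-trans (ℕD.m∣m*n p) p²∣k²))
    where
      instance _ = ℕP.m*n≢0 m' m'
      p²∣k² : (p ℕ.* p) ℕD.∣ (k ℕ.* k)
      p²∣k² = ℕD.*-cancelˡ-∣ (m' ℕ.* m')
                (subst₂ ℕD._∣_ (trans n≡[m'p]² ([m'p]²≡m'²p² m' p)) ([m'p]²≡m'²p² m' k) n∣)

  unit⇒sqStar : ∀ {c} → Unit c → SqStar n (weight c)
  unit⇒sqStar {c} uc = weight≢0 , fromℕ< (m%n<n (m' ℕ.* k) n) , (r ℕ.* r) / n , (begin
      toℕ (fromℕ< (m%n<n (m' ℕ.* k) n)) ℕ.* toℕ (fromℕ< (m%n<n (m' ℕ.* k) n))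
        ≡⟨ cong (λ t → t ℕ.* t) (FinP.toℕ-fromℕ< (m%n<n (m' ℕ.* k) n)) ⟩
      r ℕ.* r                                ≡⟨ m≡m%n+[m/n]*n (r ℕ.* r) n ⟩
      (r ℕ.* r) % n ℕ.+ (r ℕ.* r) / n ℕ.* n   ≡⟨ ℕP.+-comm _ ((r ℕ.* r) / n ℕ.* n) ⟩
      (r ℕ.* r) / n ℕ.* n ℕ.+ (r ℕ.* r) % n   ≡⟨ cong ((r ℕ.* r) / n ℕ.* n ℕ.+_) (sym (%-distribˡ-* (m' ℕ.* k) (m' ℕ.* k) n)) ⟩
      (r ℕ.* r) / n ℕ.* n ℕ.+ m'k² k % n     ≡⟨ cong ((r ℕ.* r) / n ℕ.* n ℕ.+_) (sym (FinP.toℕ-fromℕ< (m%n<n (m'k² k) n))) ⟩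
      (r ℕ.* r) / n ℕ.* n ℕ.+ toℕ (weight c) ∎)
    where
      open ≡-Reasoning
      k = abs c
      r = (m' ℕ.* k) % n
      weight≢0 : toℕ (weight c) ≢ 0
      weight≢0 w≡0 = uc (∣ᵤ⇒∣ {P} {c} (n∣m'k²⇒p∣k k
        (ℕD.m%n≡0⇒n∣m (m'k² k) n (trans (sym (FinP.toℕ-fromℕ< (m%n<n (m'k² k) n))) w≡0))))

  p²∣⇒n∣ : ∀ cs xs → P² ∣ sqWeightedSum cs (map rep xs) → n ℕD.∣ weightedSum (map weight cs) xs
  p²∣⇒n∣ cs xs p²∣ with m'²*absSqWeightedSum cs xs
  ... | K , eq = ℕD.∣m+n∣m⇒∣n (subst (n ℕD.∣_) (trans eq (ℕP.+-comm _ (K ℕ.* n))) n∣m'²S) (ℕD.n∣m*n K)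
    where
      p²∣S : (p ℕ.* p) ℕD.∣ absSqWeightedSum cs xs
      p²∣S = subst (ℕD._∣ absSqWeightedSum cs xs) (ℤP.abs-* P P)
                   (∣⇒∣ᵤ (subst (P² ∣_) (sqWeightedSum-rep cs xs) p²∣))
      n∣m'²S : n ℕD.∣ (m' ℕ.* m') ℕ.* absSqWeightedSum cs xs
      n∣m'²S = subst (ℕD._∣ (m' ℕ.* m') ℕ.* absSqWeightedSum cs xs) (sym (trans n≡[m'p]² ([m'p]²≡m'²p² m' p)))
                     (ℕD.*-monoʳ-∣ (m' ℕ.* m') p²∣S)

  allUnit⇒allSqStar : ∀ {cs} → All Unit cs → All (SqStar n) (map weight cs)
  allUnit⇒allSqStar [] = []
  allUnit⇒allSqStar (uc ∷ ucs) = unit⇒sqStar uc ∷ allUnit⇒allSqStar ucs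

  allHave9 : AllHaveConsecWZS n 9
  allHave9 xs |xs|≡9 with nine⇒zeroSegment (map rep xs) (ℕP.≤-reflexive (sym (trans (length-map rep xs) |xs|≡9)))
  ... | pre , seg , suf , eq , 1≤|seg| , cs , |cs|≡ , ucs , p²∣
    with map-≡-++⁻ rep xs pre eq
  ... | xs-pre , xs-rest , refl , _ , eq-rest
    with map-≡-++⁻ rep xs-rest seg eq-rest
  ... | xs-seg , xs-suf , refl , refl , _ =
      xs-pre , xs-seg , xs-suf , refl , subst (1 ℕ.≤_) |seg|≡ 1≤|seg| ,
      map weight cs , trans (length-map weight cs) (trans |cs|≡ |seg|≡) , allUnit⇒allSqStar ucs ,
      p²∣⇒n∣ cs xs-seg p²∣
    where |seg|≡ : length (map rep xs-seg) ≡ length xs-seg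
          |seg|≡ = length-map rep xs-seg

-- Decidability and the least constant

least : ∀ {P : Pred ℕ 0ℓ} → Decidable P → ∀ k → (∃ λ j → j ℕ.< k × P j) →
        ∃ λ c → c ℕ.< k × P c × (∀ j → P j → c ℕ.≤ j)
least P? (suc k) (j , j<1+k , Pj) with ℕP.anyUpTo? P? k
... | yes below with c , c<k , Pc , minimal ← least P? k below = c , ℕP.m<n⇒m<1+n c<k , Pc , minimal
... | no ¬below =
      j , j<1+k , Pj , λ i Pi → ℕP.≤-trans (ℕ.s≤s⁻¹ j<1+k) (ℕP.≮⇒≥ (λ i<k → ¬below (i , i<k , Pi)))

splits? : ∀ {A : Set} (xs : List A) {R : List A → List A → Set} → (∀ ys zs → Dec (R ys zs)) →
          Dec (∃₂ λ ys zs → xs ≡ ys ++ zs × R ys zs)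
splits? [] R? with R? [] []
... | yes r = yes ([] , [] , refl , r)
... | no ¬r = no λ { ([] , [] , refl , r) → ¬r r }
splits? (x ∷ xs) R? with R? [] (x ∷ xs) | splits? xs (λ ys zs → R? (x ∷ ys) zs)
... | yes r | _ = yes ([] , x ∷ xs , refl , r)
... | no _ | yes (ys , zs , xs≡ , r) = yes (x ∷ ys , zs , cong (x ∷_) xs≡ , r)
... | no ¬r | no ¬rest = no λ { ([] , _ , refl , r) → ¬r r ; (_ ∷ ys , zs , refl , r) → ¬rest (ys , zs , refl , r) }

module _ {n : ℕ} where

  all-of-length? : ∀ k {P : Pred (List (Fin n)) 0ℓ} → Decidable P → Dec (∀ xs → length xs ≡ k → P xs)
  all-of-length? zero P? with P? []
  ... | yes P[] = yes λ { [] refl → P[] }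
  ... | no ¬P[] = no λ all → ¬P[] (all [] refl)
  all-of-length? (suc k) P? with FinP.all? (λ x → all-of-length? k (λ xs → P? (x ∷ xs)))
  ... | yes all = yes λ { (x ∷ xs) |xs|≡ → all x xs (ℕP.suc-injective |xs|≡) }
  ... | no ¬all = no λ all → ¬all (λ x xs |xs|≡ → all (x ∷ xs) (cong suc |xs|≡))

  any-of-length? : ∀ k {Q : Pred (Fin n) 0ℓ} {P : Pred (List (Fin n)) 0ℓ} → Decidable Q → Decidable P →
                   Dec (∃ λ ws → length ws ≡ k × All Q ws × P ws)
  any-of-length? zero Q? P? with P? []
  ... | yes P[] = yes ([] , refl , [] , P[])
  ... | no ¬P[] = no λ { ([] , _ , _ , P[]) → ¬P[] P[] }
  any-of-length? (suc k) Q? P? with FinP.any? (λ w → Q? w ×-dec any-of-length? k Q? (λ ws → P? (w ∷ ws)))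
  ... | yes (w , Qw , ws , |ws|≡ , Qws , Pw∷ws) = yes (w ∷ ws , cong suc |ws|≡ , Qw ∷ Qws , Pw∷ws)
  ... | no ¬any = no λ { (w ∷ ws , |ws|≡ , Qw ∷ Qws , P) → ¬any (w , Qw , ws , ℕP.suc-injective |ws|≡ , Qws , P) }

module Decision (n : ℕ) {{_ : NonZero n}} where

  sqStar? : Decidable (SqStar n)
  sqStar? a = ¬? (toℕ a ℕP.≟ 0) ×-dec map′ to from (FinP.any? (λ x → (toℕ x ℕ.* toℕ x) % n ℕP.≟ toℕ a))
    where
      RootMod : Set
      RootMod = ∃ λ x → (toℕ x ℕ.* toℕ x) % n ≡ toℕ a
      Root : Set
      Root = Σ (Fin n) λ x → ∃ λ q → toℕ x ℕ.* toℕ x ≡ q ℕ.* n ℕ.+ toℕ a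
      to : RootMod → Root
      to (x , x²%n≡a) = x , (toℕ x ℕ.* toℕ x) / n ,
        trans (m≡m%n+[m/n]*n (toℕ x ℕ.* toℕ x) n)
              (trans (ℕP.+-comm ((toℕ x ℕ.* toℕ x) % n) _) (cong ((toℕ x ℕ.* toℕ x) / n ℕ.* n ℕ.+_) x²%n≡a))
      from : Root → RootMod
      from (x , q , x²≡) = x , trans (cong (_% n) (trans x²≡ (ℕP.+-comm (q ℕ.* n) (toℕ a))))
                                     (trans ([m+kn]%n≡m%n (toℕ a) q n) (m<n⇒m%n≡m (FinP.toℕ<n a)))

  ZeroSumSegment : List (Fin n) → Set
  ZeroSumSegment seg = (1 ℕ.≤ length seg) ×
    (∃ λ ws → (length ws ≡ length seg) × All (SqStar n) ws × (n ℕD.∣ weightedSum ws seg))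

  zeroSumSegment? : Decidable ZeroSumSegment
  zeroSumSegment? seg = (1 ℕP.≤? length seg) ×-dec
    any-of-length? (length seg) sqStar? (λ ws → n ℕD.∣? weightedSum ws seg)

  hasConsecWZS? : Decidable (HasConsecWZS n)
  hasConsecWZS? xs = map′ to from (splits? xs (λ _ rest → splits? rest (λ seg _ → zeroSumSegment? seg)))
    where
      Split : Set
      Split = ∃₂ λ pre rest → xs ≡ pre ++ rest × ∃₂ λ seg suf → rest ≡ seg ++ suf × ZeroSumSegment seg
      to : Split → HasConsecWZS n xs
      to (pre , _ , xs≡ , seg , suf , refl , zs) = pre , seg , suf , xs≡ , zs
      from : HasConsecWZS n xs → Split
      from (pre , seg , suf , xs≡ , zs) = pre , seg ++ suf , xs≡ , seg , suf , refl , zs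

  allHaveConsecWZS? : ∀ k → Dec (AllHaveConsecWZS n k)
  allHaveConsecWZS? k = all-of-length? k hasConsecWZS?

  C≤9 : AllHaveConsecWZS n 9 → ∃ λ c → IsC n c × c ℕ.≤ 9
  C≤9 all9 with least (λ k → 1 ℕP.≤? k ×-dec allHaveConsecWZS? k) 10 (9 , ℕP.≤-refl , s≤s z≤n , all9)
  ... | c , c<10 , (1≤c , allc) , minimal =
        c , (1≤c , allc , λ k 1≤k allk → minimal k (1≤k , allk)) , ℕ.s≤s⁻¹ c<10

open import Data.Nat using (_*_; _≤_; _<_)

1<m*m⇒1<m : ∀ m → 1 < m * m → 1 < m
1<m*m⇒1<m (suc (suc m)) _ = s≤s (s≤s z≤n)
1<m*m⇒1<m 1 (s≤s ())

prime-factor : ∀ {m} → 1 < m → ∃₂ λ p m' → Prime p × m ≡ m' * p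
prime-factor {m} 1<m with factorise m {{ℕ.>-nonZero (ℕP.<-trans (s≤s z≤n) 1<m)}}
... | record { factors = [] ; isFactorisation = m≡1 } = ⊥-elim (ℕP.<⇒≢ 1<m (sym m≡1))
... | record { factors = p ∷ ps ; isFactorisation = m≡pps ; factorsPrime = p-prime ∷ _ } =
      p , product ps , p-prime , trans m≡pps (ℕP.*-comm p (product ps))

odd-divisor : ∀ {n d} → Odd n → d ℕD.∣ n → ∃ λ h → d ≡ suc (h ℕ.+ h)
odd-divisor {n} {d} (r , n≡1+2r) d∣n with d % 2 | m%n<n d 2 | m≡m%n+[m/n]*n d 2
... | 0 | _ | d≡2q = ⊥-elim (2≢1 (ℕD.∣1⇒≡1 (ℕD.∣m+n∣m⇒∣n 2∣2r+1 (ℕD.n∣m*n r))))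
  where
    2≢1 : 2 ≢ 1
    2≢1 ()
    2∣2r+1 : 2 ℕD.∣ r * 2 ℕ.+ 1
    2∣2r+1 = subst (2 ℕD.∣_) (trans n≡1+2r (rearrange r)) (ℕD.∣-trans (ℕD.divides (d / 2) d≡2q) d∣n)
      where rearrange : ∀ r → suc (2 * r) ≡ r * 2 ℕ.+ 1
            rearrange = ℕSolver.solve-∀
... | 1 | _ | d≡1+2q = d / 2 , trans d≡1+2q (rearrange (d / 2))
  where rearrange : ∀ q → 1 ℕ.+ q * 2 ≡ suc (q ℕ.+ q)
        rearrange = ℕSolver.solve-∀
... | suc (suc _) | s≤s (s≤s ()) | _

theorem11 : (n m : ℕ) → n ≡ m * m → Odd n → 1 < n →
    ∃[ c ] (IsC n c × c ≤ 9)
theorem11 n m n≡m² n-odd 1<n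
  with p , m' , p-prime , m≡m'p ← prime-factor (1<m*m⇒1<m m (subst (1 <_) n≡m² 1<n))
  with h , p≡1+2h ← odd-divisor n-odd
                      (subst (p ℕD.∣_) (sym n≡m²) (ℕD.∣-trans (ℕD.divides m' m≡m'p) (ℕD.m∣m*n m)))
  = Decision.C≤9 n (Transfer.allHave9 n m' p h p-prime p≡1+2h n≡[m'p]²)
  where
    n≡[m'p]² = trans n≡m² (cong (λ k → k * k) m≡m'p)
    instance
      n≢0 : NonZero n
      n≢0 = ℕ.>-nonZero (ℕP.<-trans (s≤s z≤n) 1<n)
      m'≢0 : NonZero m'
      m'≢0 = ℕP.m*n≢0⇒m≢0 m' {{ℕP.m*n≢0⇒m≢0 (m' * p) {{subst NonZero n≡[m'p]² n≢0}}}}
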